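{- Let $G$ be a non-trivial finite group. If $G \not\cong \mathbb{Z}_2$, then the girth of $\mathrm{Endo}(G)$ is $3$. Moreover, $\mathrm{Endo}(G)$ is bipartite if and only if $G \cong \mathbb{Z}_2$.
   Context: For a finite group $G$, $\mathrm{Endo}(G)$ is the simple undirected graph with vertex set $G$ in which distinct $a,b$ are adjacent iff there is a group endomorphism of $G$ mapping $a$ to $b$ or mapping $b$ to $a$. The girth is the length of a shortest cycle. A graph is bipartite if its vertex set can be partitioned into two non-empty sets such that every edge has one end in each set. -}

module Defs where

open import Data.Nat using (ℕ; _<_; _≥_; _<?_)
import Data.Nat
import Data.Fin
import Relation.Nullary
import Data.Bool
open import Data.Fin using (Fin; zero; suc)
open import Data.Bool using (Bool)
open import Data.Product using (Σ; ∃; _×_; _,_)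
open import Data.Sum using (_⊎_)
open import Relation.Nullary using (¬_)
open import Relation.Binary.PropositionalEquality using (_≡_; _≢_)
open import Function.Definitions using (Injective)
open import Algebra.Core using (Op₁; Op₂)
open import Algebra.Structures using (IsGroup)
open import Algebra.Bundles.Raw using (RawGroup)
open import Algebra.Morphism.Structures using (module GroupMorphisms)

-- A finite group, presented (up to isomorphism) on the carrier Fin order,
-- with propositional equality as the group equality.
record FiniteGroup : Set₁ where
  field
    order   : ℕ
    _∙_     : Op₂ (Fin order)
    ε       : Fin order
    _⁻¹     : Op₁ (Fin order)
    isGroup : IsGroup _≡_ _∙_ ε _⁻¹

  Elt : Set
  Elt = Fin order

  rawGroup : RawGroup _ _
  rawGroup = record { Carrier = Fin order ; _≈_ = _≡_ ; _∙_ = _∙_ ; ε = ε ; _⁻¹ = _⁻¹ }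

open FiniteGroup public using (Elt; rawGroup)

NonTrivial : FiniteGroup → Set
NonTrivial G = Σ (Elt G) λ x → x ≢ FiniteGroup.ε G

IsEndomorphism : (G : FiniteGroup) → (Elt G → Elt G) → Set
IsEndomorphism G f = GroupMorphisms.IsGroupHomomorphism (rawGroup G) (rawGroup G) f

_+₂_ : Fin 2 → Fin 2 → Fin 2
zero +₂ y = y
suc zero +₂ zero = suc zero
suc zero +₂ suc zero = zero

Z₂ : RawGroup _ _
Z₂ = record { Carrier = Fin 2 ; _≈_ = _≡_ ; _∙_ = _+₂_ ; ε = zero ; _⁻¹ = λ x → x }

IsoZ₂ : FiniteGroup → Set
IsoZ₂ G = Σ (Elt G → Fin 2) λ f → GroupMorphisms.IsGroupIsomorphism (rawGroup G) Z₂ f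

-- Simple graphs, given by a vertex type and an (irreflexive, symmetric) adjacency relation.

record Graph : Set₁ where
  field
    V   : Set
    Adj : V → V → Set

open Graph public

Endo : FiniteGroup → Graph
Endo G = record
  { V   = Elt G
  ; Adj = λ a b → (a ≢ b) ×
          Σ (Elt G → Elt G) λ f → IsEndomorphism G f × ((f a ≡ b) ⊎ (f b ≡ a)) }

-- A cycle of length k (k ≥ 3): k distinct vertices v₀,…,v_{k-1} with
-- v_i adjacent to v_{i+1 mod k}.
next : {k : ℕ} → Fin k → Fin k
next {ℕ.suc k} i with Data.Fin.toℕ i Data.Nat.<? k
... | Relation.Nullary.yes p = suc (Data.Fin.fromℕ< p)
... | Relation.Nullary.no  _ = zero

HasCycleOfLength : Graph → ℕ → Set
HasCycleOfLength Γ k =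
  (k ≥ 3) × Σ (Fin k → V Γ) λ v → Injective _≡_ _≡_ v × (∀ i → Adj Γ (v i) (v (next i)))

GirthIs : Graph → ℕ → Set
GirthIs Γ g = HasCycleOfLength Γ g × (∀ k → k < g → ¬ HasCycleOfLength Γ k)

IsBipartite : Graph → Set
IsBipartite Γ = Σ (V Γ → Bool) λ c →
  (Σ (V Γ) λ x → c x ≡ Bool.true) × (Σ (V Γ) λ y → c y ≡ Bool.false) ×
  (∀ a b → Adj Γ a b → c a ≢ c b)

-- Every vertex of Endo(G) is adjacent to the identity ε through the trivial
-- endomorphism, so G has a triangle as soon as some endomorphism moves a
-- non-identity element a to a non-identity element b ≠ a; a triangle forces
-- girth 3 and rules out a bipartition. Such a, b exist unless G ≅ Z₂: if G is
-- not abelian, conjugation by g moves any h not commuting with g; if G is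
-- abelian with some y² ≠ ε, inversion moves y; and if G is an elementary
-- abelian 2-group with elements x and z ∉ {ε, x}, a subgroup H of index two
-- avoiding x (grown greedily) yields the endomorphism that is trivial on H and
-- sends its complement to z. Conversely, an isomorphism G ≅ Z₂ is itself a
-- proper 2-colouring.

{-# OPTIONS --safe #-}
module Submission where

open import Defs
open import Algebra.Bundles using (Group; CommutativeSemigroup)
open import Algebra.Definitions using (Commutative)
open import Algebra.Morphism.Definitions using (Homomorphic₂)
open import Algebra.Morphism.Structures using (module GroupMorphisms)
open import Algebra.Structures using (IsGroup)
import Algebra.Properties.CommutativeSemigroup as CommutativeSemigroupProperties
import Algebra.Properties.Group as GroupProperties
open import Data.Bool using (Bool; true; false; not; if_then_else_)
open import Data.Bool.Properties using (¬-not; not-involutive)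
open import Data.Fin using (Fin; _≟_)
open import Data.Fin.Patterns using (0F; 1F; 2F)
open import Data.Fin.Properties using (0≢1+n; all?; ¬∀⟶∃¬; 2↔Bool)
open import Data.List using (List; []; _∷_; allFin)
open import Data.List.Membership.Propositional using (_∈_)
open import Data.List.Membership.Propositional.Properties using (∈-allFin)
open import Data.List.Relation.Unary.Any using (here; there)
open import Data.Nat.Properties using (≤-refl; <⇒≱)
open import Data.Product using (Σ; ∃; ∃₂; _×_; _,_; proj₂)
open import Data.Sum using (_⊎_; inj₁; inj₂; [_,_])
import Data.Sum as Sum
open import Function using (_∘_; const)
open import Function.Bundles using (_⇔_; mk⇔; Bijection; Inverse)
open import Function.Construct.Composition using (bijective)
open import Function.Definitions using (Bijective; Surjective)
open import Function.Properties.Inverse using (Inverse⇒Bijection)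
open import Relation.Binary.Definitions using (Irreflexive)
open import Relation.Binary.PropositionalEquality
  using (_≡_; _≢_; refl; sym; trans; cong; cong₂; subst; module ≡-Reasoning)
open import Relation.Nullary using (¬_; Dec; yes; no; does; contradiction)
open import Relation.Nullary.Decidable using (dec-true; dec-false; _⊎-dec_)
open import Relation.Unary using (Decidable)

Triangle : Graph → Set
Triangle Γ = Σ (V Γ) λ a → Σ (V Γ) λ b → Σ (V Γ) λ c →
  Adj Γ a b × Adj Γ b c × Adj Γ c a

module _ {Γ : Graph} where

  triangle⇒cycle₃ : Irreflexive _≡_ (Adj Γ) → Triangle Γ → HasCycleOfLength Γ 3
  triangle⇒cycle₃ irrefl (a , b , c , ab , bc , ca) = ≤-refl , v , v-injective , v-adjacent
    where
    v : Fin 3 → V Γ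
    v 0F = a
    v 1F = b
    v 2F = c
    v-injective : ∀ {i j} → v i ≡ v j → i ≡ j
    v-injective {0F} {0F} _ = refl
    v-injective {0F} {1F} e = contradiction ab (irrefl e)
    v-injective {0F} {2F} e = contradiction ca (irrefl (sym e))
    v-injective {1F} {0F} e = contradiction ab (irrefl (sym e))
    v-injective {1F} {1F} _ = refl
    v-injective {1F} {2F} e = contradiction bc (irrefl e)
    v-injective {2F} {0F} e = contradiction ca (irrefl e)
    v-injective {2F} {1F} e = contradiction bc (irrefl (sym e))
    v-injective {2F} {2F} _ = refl
    v-adjacent : ∀ i → Adj Γ (v i) (v (next i))
    v-adjacent 0F = ab
    v-adjacent 1F = bc
    v-adjacent 2F = ca

  triangle⇒girth₃ : Irreflexive _≡_ (Adj Γ) → Triangle Γ → GirthIs Γ 3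
  triangle⇒girth₃ irrefl t = triangle⇒cycle₃ irrefl t , λ k k<3 (k≥3 , _) → <⇒≱ k<3 k≥3

  triangle⇒¬bipartite : Triangle Γ → ¬ IsBipartite Γ
  triangle⇒¬bipartite (a , b , c , ab , bc , ca) (colour , _ , _ , proper) =
    proper c a ca (sym (begin
      colour a             ≡⟨ ¬-not (proper a b ab) ⟩
      not (colour b)       ≡⟨ cong not (¬-not (proper b c bc)) ⟩
      not (not (colour c)) ≡⟨ not-involutive (colour c) ⟩
      colour c             ∎))
    where open ≡-Reasoning

  bijective-colouring⇒bipartite : Irreflexive _≡_ (Adj Γ) →
    (colour : V Γ → Bool) → Bijective _≡_ _≡_ colour → IsBipartite Γ
  bijective-colouring⇒bipartite irrefl colour (injective , surjective) =
    colour , coloured true , coloured false ,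
    λ a b ab same → irrefl (injective same) ab
    where
    coloured : ∀ β → Σ (V Γ) λ v → colour v ≡ β
    coloured β = let (v , colour≡β) = surjective β in v , colour≡β refl

module _ (G : FiniteGroup) where
  open FiniteGroup G using (ε; isGroup; order) renaming (_∙_ to infixl 7 _∙_; _⁻¹ to infix 8 _⁻¹)
  open IsGroup isGroup using (assoc; identityˡ; identityʳ; inverseˡ; inverseʳ; isSemigroup)

  private
    group : Group _ _
    group = record { isGroup = isGroup }

  open GroupProperties group using
    ( ∙-cancelˡ; inverseˡ-unique; ε⁻¹≈ε; ⁻¹-injective; ⁻¹-anti-homo-∙
    ; \\-leftDividesʳ; //-rightDividesˡ)

  Endo-irreflexive : Irreflexive _≡_ (Adj (Endo G))
  Endo-irreflexive a≡b (a≢b , _) = a≢b a≡b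

  homomorphism⇒endomorphism : ∀ {f} → Homomorphic₂ (Elt G) (Elt G) _≡_ f _∙_ _∙_ →
                              IsEndomorphism G f
  homomorphism⇒endomorphism {f} homo = record
    { isMonoidHomomorphism = record
      { isMagmaHomomorphism = record
        { isRelHomomorphism = record { cong = cong f }
        ; homo = homo }
      ; ε-homo = f-ε }
    ; ⁻¹-homo = f-⁻¹ }
    where
    open ≡-Reasoning
    f-ε : f ε ≡ ε
    f-ε = ∙-cancelˡ (f ε) (f ε) ε (begin
      f ε ∙ f ε ≡⟨ homo ε ε ⟨
      f (ε ∙ ε) ≡⟨ cong f (identityˡ ε) ⟩
      f ε       ≡⟨ identityʳ (f ε) ⟨
      f ε ∙ ε   ∎)
    f-⁻¹ : ∀ u → f (u ⁻¹) ≡ f u ⁻¹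
    f-⁻¹ u = inverseˡ-unique (f (u ⁻¹)) (f u) (begin
      f (u ⁻¹) ∙ f u ≡⟨ homo (u ⁻¹) u ⟨
      f (u ⁻¹ ∙ u)   ≡⟨ cong f (inverseˡ u) ⟩
      f ε            ≡⟨ f-ε ⟩
      ε              ∎)

  adjacent-nonidentity⇒triangle : ∀ {a b} → a ≢ ε → b ≢ ε → Adj (Endo G) a b →
                                  Triangle (Endo G)
  adjacent-nonidentity⇒triangle {a} {b} a≢ε b≢ε ab = ε , a , b , ε—a , ab , b—ε
    where
    trivial : IsEndomorphism G (const ε)
    trivial = homomorphism⇒endomorphism λ _ _ → sym (identityˡ ε)
    ε—a : Adj (Endo G) ε a
    ε—a = a≢ε ∘ sym , const ε , trivial , inj₂ refl
    b—ε : Adj (Endo G) b ε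
    b—ε = b≢ε , const ε , trivial , inj₁ refl

  conjugation-triangle : ∀ {g h} → g ∙ h ≢ h ∙ g → Triangle (Endo G)
  conjugation-triangle {g} {h} gh≢hg =
    adjacent-nonidentity⇒triangle h≢ε conj-h≢ε
      (h≢conj-h , conj , homomorphism⇒endomorphism conj-homo , inj₁ refl)
    where
    open ≡-Reasoning
    conj : Elt G → Elt G
    conj k = g ∙ k ∙ g ⁻¹
    conj-homo : ∀ u v → conj (u ∙ v) ≡ conj u ∙ conj v
    conj-homo u v = sym (begin
      conj u ∙ (g ∙ v ∙ g ⁻¹)     ≡⟨ assoc (conj u) (g ∙ v) (g ⁻¹) ⟨
      conj u ∙ (g ∙ v) ∙ g ⁻¹     ≡⟨ cong (_∙ g ⁻¹) (assoc (conj u) g v) ⟨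
      g ∙ u ∙ g ⁻¹ ∙ g ∙ v ∙ g ⁻¹ ≡⟨ cong (λ t → t ∙ v ∙ g ⁻¹) (//-rightDividesˡ g (g ∙ u)) ⟩
      g ∙ u ∙ v ∙ g ⁻¹            ≡⟨ cong (_∙ g ⁻¹) (assoc g u v) ⟩
      conj (u ∙ v)                ∎)
    conj-h∙g : conj h ∙ g ≡ g ∙ h
    conj-h∙g = //-rightDividesˡ g (g ∙ h)
    h≢ε : h ≢ ε
    h≢ε refl = gh≢hg (trans (identityʳ g) (sym (identityˡ g)))
    conj-h≢ε : conj h ≢ ε
    conj-h≢ε conj-h≡ε = h≢ε (∙-cancelˡ g h ε (begin
      g ∙ h      ≡⟨ conj-h∙g ⟨
      conj h ∙ g ≡⟨ cong (_∙ g) conj-h≡ε ⟩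
      ε ∙ g      ≡⟨ identityˡ g ⟩
      g          ≡⟨ identityʳ g ⟨
      g ∙ ε      ∎))
    h≢conj-h : h ≢ conj h
    h≢conj-h h≡conj-h = gh≢hg (trans (sym conj-h∙g) (cong (_∙ g) (sym h≡conj-h)))

  inversion-triangle : Commutative _≡_ _∙_ → ∀ {y} → y ∙ y ≢ ε → Triangle (Endo G)
  inversion-triangle comm {y} y²≢ε =
    adjacent-nonidentity⇒triangle y≢ε y⁻¹≢ε
      (y≢y⁻¹ , _⁻¹ , homomorphism⇒endomorphism ⁻¹-homo , inj₁ refl)
    where
    ⁻¹-homo : ∀ u v → (u ∙ v) ⁻¹ ≡ u ⁻¹ ∙ v ⁻¹
    ⁻¹-homo u v = trans (⁻¹-anti-homo-∙ u v) (comm (v ⁻¹) (u ⁻¹))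
    y≢ε : y ≢ ε
    y≢ε refl = y²≢ε (identityˡ ε)
    y⁻¹≢ε : y ⁻¹ ≢ ε
    y⁻¹≢ε y⁻¹≡ε = y≢ε (⁻¹-injective (trans y⁻¹≡ε (sym ε⁻¹≈ε)))
    y≢y⁻¹ : y ≢ y ⁻¹
    y≢y⁻¹ y≡y⁻¹ = y²≢ε (trans (cong (y ∙_) y≡y⁻¹) (inverseʳ y))

  two-elements⇒IsoZ₂ : ∀ {x} → x ≢ ε → (∀ w → w ≡ ε ⊎ w ≡ x) → IsoZ₂ G
  two-elements⇒IsoZ₂ {x} x≢ε ε-or-x = parity , record
    { isGroupMonomorphism = record
      { isGroupHomomorphism = record
        { isMonoidHomomorphism = record
          { isMagmaHomomorphism = record
            { isRelHomomorphism = record { cong = cong parity }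
            ; homo = homo }
          ; ε-homo = parity-ε }
        ; ⁻¹-homo = ⁻¹-homo }
      ; injective = injective }
    ; surjective = surjective }
    where
    parity : Elt G → Fin 2
    parity w = if does (w ≟ ε) then 0F else 1F
    parity-ε : parity ε ≡ 0F
    parity-ε = cong (if_then 0F else 1F) (dec-true (ε ≟ ε) refl)
    parity-x : parity x ≡ 1F
    parity-x = cong (if_then 0F else 1F) (dec-false (x ≟ ε) x≢ε)
    x∙x≡ε : x ∙ x ≡ ε
    x∙x≡ε with ε-or-x (x ∙ x)
    ... | inj₁ x∙x≡ε = x∙x≡ε
    ... | inj₂ x∙x≡x = contradiction (∙-cancelˡ x x ε (trans x∙x≡x (sym (identityʳ x)))) x≢ε
    parity-ε≢x : parity ε ≢ parity x
    parity-ε≢x same = 0≢1+n (trans (sym parity-ε) (trans same parity-x))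
    homo : ∀ u v → parity (u ∙ v) ≡ parity u +₂ parity v
    homo u v with ε-or-x u | ε-or-x v
    ... | inj₁ refl | inj₁ refl rewrite identityˡ ε | parity-ε = refl
    ... | inj₁ refl | inj₂ refl rewrite identityˡ x | parity-ε | parity-x = refl
    ... | inj₂ refl | inj₁ refl rewrite identityʳ x | parity-ε | parity-x = refl
    ... | inj₂ refl | inj₂ refl rewrite x∙x≡ε | parity-ε | parity-x = refl
    ⁻¹-homo : ∀ u → parity (u ⁻¹) ≡ parity u
    ⁻¹-homo u with ε-or-x u
    ... | inj₁ refl = cong parity ε⁻¹≈ε
    ... | inj₂ refl = cong parity (sym (inverseˡ-unique x x x∙x≡ε))
    injective : ∀ {u v} → parity u ≡ parity v → u ≡ v
    injective {u} {v} with ε-or-x u | ε-or-x v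
    ... | inj₁ refl | inj₁ refl = λ _ → refl
    ... | inj₂ refl | inj₂ refl = λ _ → refl
    ... | inj₁ refl | inj₂ refl = λ same → contradiction same parity-ε≢x
    ... | inj₂ refl | inj₁ refl = λ same → contradiction (sym same) parity-ε≢x
    surjective : Surjective _≡_ _≡_ parity
    surjective 0F = ε , λ { refl → parity-ε }
    surjective 1F = x , λ { refl → parity-x }

  module ExponentTwo (square≡ε : ∀ u → u ∙ u ≡ ε) where
    open ≡-Reasoning

    self-inverse : ∀ u → u ⁻¹ ≡ u
    self-inverse u = sym (inverseˡ-unique u u (square≡ε u))

    comm : Commutative _≡_ _∙_
    comm u v = begin
      u ∙ v         ≡⟨ self-inverse (u ∙ v) ⟨
      (u ∙ v) ⁻¹    ≡⟨ ⁻¹-anti-homo-∙ u v ⟩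
      v ⁻¹ ∙ u ⁻¹   ≡⟨ cong₂ _∙_ (self-inverse v) (self-inverse u) ⟩
      v ∙ u         ∎

    commutativeSemigroup : CommutativeSemigroup _ _
    commutativeSemigroup = record
      { isCommutativeSemigroup = record { isSemigroup = isSemigroup ; comm = comm } }

    open CommutativeSemigroupProperties commutativeSemigroup using (interchange; x∙yz≈y∙xz)

    x∙xy≡y : ∀ u v → u ∙ (u ∙ v) ≡ v
    x∙xy≡y u v = trans (cong (_∙ (u ∙ v)) (sym (self-inverse u))) (\\-leftDividesʳ u v)

    xy∙y≡x : ∀ u v → u ∙ v ∙ v ≡ u
    xy∙y≡x u v = trans (assoc u v v) (trans (cong (u ∙_) (square≡ε v)) (identityʳ u))

    xy∙zy≡xz : ∀ u v w → u ∙ v ∙ (w ∙ v) ≡ u ∙ w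
    xy∙zy≡xz u v w =
      trans (interchange u v w v) (trans (cong (u ∙ w ∙_) (square≡ε v)) (identityʳ (u ∙ w)))

    xy∙xz≡yz : ∀ u v w → u ∙ v ∙ (u ∙ w) ≡ v ∙ w
    xy∙xz≡yz u v w =
      trans (interchange u v u w) (trans (cong (_∙ (v ∙ w)) (square≡ε u)) (identityˡ (v ∙ w)))

    -- ⟨g ∷ gs⟩ = ⟨gs⟩ ∪ g⟨gs⟩, and w ∈ g⟨gs⟩ iff g ∙ w ∈ ⟨gs⟩ as g is self-inverse.
    Span : List (Elt G) → Elt G → Set
    Span []       w = w ≡ ε
    Span (g ∷ gs) w = Span gs w ⊎ Span gs (g ∙ w)

    Span? : ∀ gs → Decidable (Span gs)
    Span? []       w = w ≟ ε
    Span? (g ∷ gs) w = Span? gs w ⊎-dec Span? gs (g ∙ w)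

    Span-ε : ∀ gs → Span gs ε
    Span-ε []       = refl
    Span-ε (g ∷ gs) = inj₁ (Span-ε gs)

    Span-head : ∀ g gs → Span (g ∷ gs) g
    Span-head g gs = inj₂ (subst (Span gs) (sym (square≡ε g)) (Span-ε gs))

    Span-∙ : ∀ gs {u v} → Span gs u → Span gs v → Span gs (u ∙ v)
    Span-∙ []       refl      refl      = identityˡ ε
    Span-∙ (g ∷ gs) (inj₁ u∈) (inj₁ v∈) = inj₁ (Span-∙ gs u∈ v∈)
    Span-∙ (g ∷ gs) {u} {v} (inj₂ gu∈) (inj₁ v∈) =
      inj₂ (subst (Span gs) (assoc g u v) (Span-∙ gs gu∈ v∈))
    Span-∙ (g ∷ gs) {u} {v} (inj₁ u∈) (inj₂ gv∈) =
      inj₂ (subst (Span gs) (x∙yz≈y∙xz u g v) (Span-∙ gs u∈ gv∈))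
    Span-∙ (g ∷ gs) {u} {v} (inj₂ gu∈) (inj₂ gv∈) =
      inj₁ (subst (Span gs) (xy∙xz≡yz g u v) (Span-∙ gs gu∈ gv∈))

    module _ {H : Elt G → Set} (H? : Decidable H)
             (H-∙ : ∀ {u v} → H u → H v → H (u ∙ v))
             (H-index₂ : ∀ {u v} → ¬ H u → ¬ H v → H (u ∙ v))
             (z : Elt G) where

      indicator : Elt G → Elt G
      indicator w = if does (H? w) then ε else z

      indicator-homo : ∀ u v → indicator (u ∙ v) ≡ indicator u ∙ indicator v
      indicator-homo u v with H? u | H? v | H? (u ∙ v)
      ... | yes _   | yes _   | yes _    = sym (identityˡ ε)
      ... | yes _   | no  _   | no  _    = sym (identityˡ z)
      ... | no  _   | yes _   | no  _    = sym (identityʳ z)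
      ... | no  _   | no  _   | yes _    = sym (square≡ε z)
      ... | yes u∈H | yes v∈H | no  uv∉H = contradiction (H-∙ u∈H v∈H) uv∉H
      ... | yes u∈H | no  v∉H | yes uv∈H =
        contradiction (subst H (x∙xy≡y u v) (H-∙ u∈H uv∈H)) v∉H
      ... | no  u∉H | yes v∈H | yes uv∈H =
        contradiction (subst H (xy∙y≡x u v) (H-∙ uv∈H v∈H)) u∉H
      ... | no  u∉H | no  v∉H | no  uv∉H = contradiction (H-index₂ u∉H v∉H) uv∉H

      indicator-outside : ∀ {w} → ¬ H w → indicator w ≡ z
      indicator-outside {w} w∉H = cong (if_then ε else z) (dec-false (H? w) w∉H)

    module _ {x} (x≢ε : x ≢ ε) where

      record Hyperplane (vs : List (Elt G)) : Set where
        field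
          gens   : List (Elt G)
          x∉     : ¬ Span gens x
          covers : ∀ {v} → v ∈ vs → Span gens v ⊎ Span gens (v ∙ x)

      -- Greedily add v to the generators unless that would put x in the span,
      -- in which case v ∙ x already lies in it.
      extend : ∀ {vs} v → Hyperplane vs → Hyperplane (v ∷ vs)
      extend v record { gens = gens ; x∉ = x∉ ; covers = covers } with Span? (v ∷ gens) x
      ... | yes (inj₁ x∈) = contradiction x∈ x∉
      ... | yes (inj₂ vx∈) = record
        { gens   = gens
        ; x∉     = x∉
        ; covers = λ { (here refl) → inj₂ vx∈ ; (there w∈) → covers w∈ } }
      ... | no x∉′ = record
        { gens   = v ∷ gens
        ; x∉     = x∉′
        ; covers = λ { (here refl) → inj₁ (Span-head v gens)
                     ; (there w∈) → Sum.map inj₁ inj₁ (covers w∈) } }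

      hyperplane : ∀ vs → Hyperplane vs
      hyperplane []       = record { gens = [] ; x∉ = x≢ε ; covers = λ () }
      hyperplane (v ∷ vs) = extend v (hyperplane vs)

      IsoZ₂⊎triangle : IsoZ₂ G ⊎ Triangle (Endo G)
      IsoZ₂⊎triangle with all? (λ w → w ≟ ε ⊎-dec w ≟ x)
      ... | yes ε-or-x = inj₁ (two-elements⇒IsoZ₂ x≢ε ε-or-x)
      ... | no ¬ε-or-x with ¬∀⟶∃¬ order _ (λ w → w ≟ ε ⊎-dec w ≟ x) ¬ε-or-x
      ...   | z , z∉εx = inj₂ (adjacent-nonidentity⇒triangle x≢ε (z∉εx ∘ inj₁)
                (x≢z , f , homomorphism⇒endomorphism (indicator-homo H? H-∙ H-index₂ z) ,
                 inj₁ (indicator-outside H? H-∙ H-index₂ z x∉)))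
        where
        open Hyperplane (hyperplane (allFin order))
        H : Elt G → Set
        H = Span gens
        H? : Decidable H
        H? = Span? gens
        H-∙ : ∀ {u v} → H u → H v → H (u ∙ v)
        H-∙ = Span-∙ gens
        H-index₂ : ∀ {u v} → ¬ H u → ¬ H v → H (u ∙ v)
        H-index₂ {u} {v} u∉H v∉H = subst H (xy∙zy≡xz u x v) (H-∙ (ux∈H u∉H) (ux∈H v∉H))
          where
          ux∈H : ∀ {w} → ¬ H w → H (w ∙ x)
          ux∈H {w} w∉H =
            Sum.fromInj₂ (λ w∈H → contradiction w∈H w∉H) (covers (∈-allFin w))
        f : Elt G → Elt G
        f = indicator H? H-∙ H-index₂ z
        x≢z : x ≢ z
        x≢z x≡z = z∉εx (inj₂ (sym x≡z))

  central? : Decidable λ g → ∀ h → g ∙ h ≡ h ∙ g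
  central? g = all? λ h → g ∙ h ≟ h ∙ g

  comm? : Dec (Commutative _≡_ _∙_)
  comm? = all? central?

  noncommuting-pair : ¬ Commutative _≡_ _∙_ → ∃₂ λ g h → g ∙ h ≢ h ∙ g
  noncommuting-pair ¬comm with ¬∀⟶∃¬ order _ central? ¬comm
  ... | g , ¬g-central with ¬∀⟶∃¬ order _ (λ h → g ∙ h ≟ h ∙ g) ¬g-central
  ...   | h , gh≢hg = g , h , gh≢hg

  nontrivial-square : ¬ (∀ y → y ∙ y ≡ ε) → ∃ λ y → y ∙ y ≢ ε
  nontrivial-square = ¬∀⟶∃¬ order _ (λ y → y ∙ y ≟ ε)

  IsoZ₂⊎triangle : NonTrivial G → IsoZ₂ G ⊎ Triangle (Endo G)
  IsoZ₂⊎triangle (x , x≢ε) with all? (λ y → y ∙ y ≟ ε) | comm?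
  ... | yes square≡ε | _        = ExponentTwo.IsoZ₂⊎triangle square≡ε x≢ε
  ... | no ¬square≡ε | yes comm =
    inj₂ (inversion-triangle comm (proj₂ (nontrivial-square ¬square≡ε)))
  ... | no _         | no ¬comm =
    inj₂ (conjugation-triangle (proj₂ (proj₂ (noncommuting-pair ¬comm))))

  IsoZ₂⇒bipartite : IsoZ₂ G → IsBipartite (Endo G)
  IsoZ₂⇒bipartite (f , f-iso) =
    bijective-colouring⇒bipartite Endo-irreflexive (toBool ∘ f)
      (bijective _≡_ _≡_ _≡_ (injective , surjective) toBool-bijective)
    where
    open GroupMorphisms.IsGroupIsomorphism f-iso using (injective; surjective)
    toBool : Fin 2 → Bool
    toBool = Inverse.to 2↔Bool
    toBool-bijective : Bijective _≡_ _≡_ toBool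
    toBool-bijective = Bijection.bijective (Inverse⇒Bijection 2↔Bool)

proposition2p13 : (G : FiniteGroup) → NonTrivial G →
    (¬ IsoZ₂ G → GirthIs (Endo G) 3) × (IsBipartite (Endo G) ⇔ IsoZ₂ G)
proposition2p13 G nontrivial = girth₃ , mk⇔ bipartite⇒IsoZ₂ (IsoZ₂⇒bipartite G)
  where
  girth₃ : ¬ IsoZ₂ G → GirthIs (Endo G) 3
  girth₃ ¬iso = [ (λ iso → contradiction iso ¬iso) , triangle⇒girth₃ (Endo-irreflexive G) ]
                  (IsoZ₂⊎triangle G nontrivial)
  bipartite⇒IsoZ₂ : IsBipartite (Endo G) → IsoZ₂ G
  bipartite⇒IsoZ₂ bipartite = Sum.fromInj₁ (contradiction bipartite ∘ triangle⇒¬bipartite)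
                                (IsoZ₂⊎triangle G nontrivial)
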